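{- For every positive integer $n$ and every $u\in S_n$, \[ t^{\mathrm{des}(u)}q^{\mathrm{maj}(u)}\prod_{i=1}^n(1+tq^i) = \sum_{w\in B'(u)} t^{\mathrm{fdes}(w)}q^{\mathrm{fmaj}(w)}, \] where $B'(u)=\{w\in B_n : |w_1|\cdots|w_n| = u\}$.
   Context: $[n]=\{1,\dots,n\}$, $S_n$ is the set of permutations of $[n]$, written as words. $B_n$ is the set of signed permutations: words $w=w_1\cdots w_n$ on the alphabet $\{\bar 1,1,\dots,\bar n,n\}$ (with $\bar i=-i$) such that $|w_1|\cdots|w_n|$ is a permutation in $S_n$. The alphabet is totally ordered by $\bar 1<\bar 2<\cdots<\bar n<1<2<\cdots<n$. For a word $w$ over a totally ordered alphabet, $\mathrm{Des}(w)=\{i : w_i>w_{i+1}\}$, $\mathrm{des}(w)=|\mathrm{Des}(w)|$, $\mathrm{maj}(w)=\sum_{i\in\mathrm{Des}(w)} i$. For $w\in B_n$: $\mathrm{fdes}(w)=2\,\mathrm{des}(w)+1$ if $w_1<0$ and $\mathrm{fdes}(w)=2\,\mathrm{des}(w)$ if $w_1>0$; $\mathrm{fmaj}(w)=2\,\mathrm{maj}(w)+|\{i: w_i<0\}|$. -}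

module Defs where

open import Level using (Level)
open import Data.Bool using (Bool; true; false; if_then_else_)
open import Data.Nat as ℕ using (ℕ; zero; suc; _<ᵇ_)
open import Data.Nat.ListAction using (sum)
open import Data.Integer as ℤ using (ℤ; +_; -[1+_]; ∣_∣)
open import Data.List using (List; []; _∷_; _++_; map; length; upTo; concatMap; filter)
open import Data.List.Properties using (≡-dec)
open import Data.List.Relation.Binary.Permutation.Propositional using (_↭_)
open import Relation.Binary.PropositionalEquality using (_≡_)
open import Algebra.Bundles using (CommutativeSemiring)

-- Descents of a word over a totally ordered alphabet, given by its
-- strict order as a Boolean test `lt x y` (x < y).

desPos : {A : Set} → (A → A → Bool) → List A → ℕ → List ℕ
desPos lt [] i = []
desPos lt (x ∷ []) i = []
desPos lt (x ∷ xs@(y ∷ _)) i =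
  (if lt y x then i ∷ [] else []) ++ desPos lt xs (suc i)

Des : {A : Set} → (A → A → Bool) → List A → List ℕ
Des lt w = desPos lt w 1

des : {A : Set} → (A → A → Bool) → List A → ℕ
des lt w = length (Des lt w)

maj : {A : Set} → (A → A → Bool) → List A → ℕ
maj lt w = sum (Des lt w)

oneTo : ℕ → List ℕ
oneTo n = map suc (upTo n)

IsPerm : ℕ → List ℕ → Set
IsPerm n u = u ↭ oneTo n

ltℕ : ℕ → ℕ → Bool
ltℕ = _<ᵇ_

-- Signed letters are integers (ī = -i).  Order:
-- 1̄ < 2̄ < ... < n̄ < 1 < 2 < ... < n.
ltB : ℤ → ℤ → Bool
ltB -[1+ a ] -[1+ b ] = a <ᵇ b
ltB -[1+ a ] (+ b)    = true
ltB (+ a)    -[1+ b ] = false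
ltB (+ a)    (+ b)    = a <ᵇ b

isNeg : ℤ → Bool
isNeg -[1+ _ ] = true
isNeg (+ _)    = false

neg : List ℤ → ℕ
neg w = length (filter (λ x → Data.Bool._≟_ (isNeg x) true) w)

fdes : List ℤ → ℕ
fdes [] = 0
fdes w@(x ∷ _) = 2 ℕ.* des ltB w ℕ.+ (if isNeg x then 1 else 0)

fmaj : List ℤ → ℕ
fmaj w = 2 ℕ.* maj ltB w ℕ.+ neg w

signedAlphabet : ℕ → List ℤ
signedAlphabet n = map -[1+_] (upTo n) ++ map (λ i → + suc i) (upTo n)

words : {A : Set} → List A → ℕ → List (List A)
words alph zero = [] ∷ []
words alph (suc k) = concatMap (λ a → map (a ∷_) (words alph k)) alph

-- B'(u) = { w ∈ B_n : |w_1| ⋯ |w_n| = u }, listed without repetition: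
-- all words of length n over {1̄,…,n̄,1,…,n} whose absolute values give u
-- (for u ∈ S_n such a word is automatically in B_n).
B' : ℕ → List ℕ → List (List ℤ)
B' n u = filter (λ w → ≡-dec ℕ._≟_ (map ∣_∣ w) u) (words (signedAlphabet n) n)

module _ {c ℓ : Level} (R : CommutativeSemiring c ℓ) where
  open CommutativeSemiring R
  open import Algebra.Definitions.RawSemiring rawSemiring using (_^_)

  sumR : List Carrier → Carrier
  sumR [] = 0#
  sumR (x ∷ xs) = x + sumR xs

  prodR : List Carrier → Carrier
  prodR [] = 1#
  prodR (x ∷ xs) = x * prodR xs

  lhs7 : ℕ → List ℕ → Carrier → Carrier → Carrier
  lhs7 n u t q = (t ^ des ltℕ u) * (q ^ maj ltℕ u)
                 * prodR (map (λ i → 1# + t * (q ^ i)) (oneTo n))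

  rhs7 : ℕ → List ℕ → Carrier → Carrier → Carrier
  rhs7 n u t q = sumR (map (λ w → (t ^ fdes w) * (q ^ fmaj w)) (B' n u))

module Submission where

-- The 2ⁿ signed liftings ε₁u₁ ⋯ εₙuₙ of a permutation u are summed by a transfer
-- recursion along the word.
--  1. Combinatorics: B'(u), defined by filtering all words over {1̄,…,n̄,1,…,n}, is
--     exactly the explicit list `signings` of the liftings (`B'-signings`).
--  2. Descent products: x^des y^maj of any word is the product of x·y^i over its
--     descents i (`descent-weight`).  With (t², q²) this factorises t^fdes q^fmaj of a
--     signed word: a negative first letter adds t·q, each later negative letter q.
--  3. Transfer identity (`transfer`): for a word k v whose first letter sits at
--     position m, let P / N sum over the liftings starting with +k / -k the descent
--     product times q^(later negative letters).  Then P + t q^m N equals t^des q^maj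
--     of k v times ∏_{i=m}^{m+|v|} (1 + t q^i).  By induction on v: position m is a
--     signed descent iff the signs are (+,-), or agree and the letters descend, and
--     the two-term recursion closes by the polynomial identity `transfer-step`.
--  4. At m = 1 the left side is the sum over B'(u) (`identity-shifted`).

open import Defs
open import Level using (Level)
open import Function using (_∘_)
open import Data.Bool using (Bool; true; false; if_then_else_)
open import Data.Nat as ℕ using (ℕ; zero; suc; _<ᵇ_; _<_; _≤_; s≤s)
import Data.Nat.Properties as ℕ
open import Data.Nat.ListAction using (sum)
open import Data.Integer using (ℤ; +_; -[1+_]; ∣_∣)
open import Data.Product using (Σ; _×_; _,_)
open import Data.List using (List; []; _∷_; _++_; map; length; upTo; applyUpTo; concat; concatMap; filter)
import Data.List.Properties as List
open import Data.List.Relation.Unary.All using (All; []; _∷_)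
open import Data.List.Relation.Unary.Any using (here; there)
open import Data.List.Membership.Propositional using (_∈_)
open import Data.List.Membership.Propositional.Properties using (∈-map⁻; ∈-upTo⁻)
open import Data.List.Relation.Binary.Permutation.Propositional.Properties using (∈-resp-↭; ↭-length)
open import Relation.Nullary using (Dec; yes; no)
open import Relation.Unary using (Decidable)
open import Relation.Binary.PropositionalEquality as ≡ using (_≡_; _≢_; refl; cong; cong₂)
open import Algebra.Bundles using (CommutativeSemiring)

matches : (u : List ℕ) → Decidable (λ (w : List ℤ) → map ∣_∣ w ≡ u)
matches u w = List.≡-dec ℕ._≟_ (map ∣_∣ w) u

-- The signed liftings of the word `map suc v`: the letter suc k becomes k̄+1 or k+1.
-- (Letters are shifted down by one so that both signs are constructors of ℤ.)
signings : List ℕ → List (List ℤ)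
signings []      = [] ∷ []
signings (k ∷ v) = map (-[1+ k ] ∷_) (signings v) ++ map (+ suc k ∷_) (signings v)

filter-concatMap : ∀ {A B : Set} {P : B → Set} (P? : Decidable P) (f : A → List B) xs →
  filter P? (concatMap f xs) ≡ concatMap (filter P? ∘ f) xs
filter-concatMap P? f []       = refl
filter-concatMap P? f (x ∷ xs) =
  ≡.trans (List.filter-++ P? (f x) (concatMap f xs)) (cong (filter P? (f x) ++_) (filter-concatMap P? f xs))

concat-applyUpTo-empty : ∀ {B : Set} (h : ℕ → List B) n → (∀ i → h i ≡ []) → concat (applyUpTo h n) ≡ []
concat-applyUpTo-empty h zero    empty = refl
concat-applyUpTo-empty h (suc n) empty
  rewrite empty 0 = concat-applyUpTo-empty (h ∘ suc) n (empty ∘ suc)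

concat-applyUpTo-single : ∀ {B : Set} (h : ℕ → List B) n {k} → k < n → (∀ i → i ≢ k → h i ≡ []) →
  concat (applyUpTo h n) ≡ h k
concat-applyUpTo-single h (suc n) {zero} _ others =
  ≡.trans (cong (h 0 ++_) (concat-applyUpTo-empty (h ∘ suc) n (λ i → others (suc i) λ ())))
          (List.++-identityʳ (h 0))
concat-applyUpTo-single h (suc n) {suc k} (s≤s k<n) others
  rewrite others 0 (λ ()) =
    concat-applyUpTo-single (h ∘ suc) n k<n (λ i i≢k → others (suc i) (i≢k ∘ cong ℕ.pred))

concatMap-signedAlphabet : ∀ {B : Set} (h : ℤ → List B) n {k} → k < n →
  (∀ c → ∣ c ∣ ≢ suc k → h c ≡ []) → concatMap h (signedAlphabet n) ≡ h -[1+ k ] ++ h (+ suc k)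
concatMap-signedAlphabet h n {k} k<n others = begin
  concatMap h (map -[1+_] (upTo n) ++ map (+_ ∘ suc) (upTo n))
    ≡⟨ List.concatMap-++ h (map -[1+_] (upTo n)) _ ⟩
  concatMap h (map -[1+_] (upTo n)) ++ concatMap h (map (+_ ∘ suc) (upTo n))
    ≡⟨ cong₂ _++_ (select -[1+_] (λ _ → refl)) (select (+_ ∘ suc) (λ _ → refl)) ⟩
  h -[1+ k ] ++ h (+ suc k) ∎
  where
  open ≡.≡-Reasoning
  select : (letter : ℕ → ℤ) → (∀ i → ∣ letter i ∣ ≡ suc i) → concatMap h (map letter (upTo n)) ≡ h (letter k)
  select letter ∣letter∣ = begin
    concatMap h (map letter (upTo n))  ≡⟨ List.concatMap-map h letter (upTo n) ⟩
    concatMap (h ∘ letter) (upTo n)    ≡⟨ cong concat (List.map-upTo (h ∘ letter) n) ⟩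
    concat (applyUpTo (h ∘ letter) n)  ≡⟨ concat-applyUpTo-single (h ∘ letter) n k<n vanish ⟩
    h (letter k)                       ∎
    where
    vanish : ∀ i → i ≢ k → h (letter i) ≡ []
    vanish i i≢k = others (letter i) (λ eq → i≢k (cong ℕ.pred (≡.trans (≡.sym (∣letter∣ i)) eq)))

filter-prefix-mismatch : ∀ {x u} c → ∣ c ∣ ≢ x → (ws : List (List ℤ)) →
  filter (matches (x ∷ u)) (map (c ∷_) ws) ≡ []
filter-prefix-mismatch c c≢x []       = refl
filter-prefix-mismatch {x} {u} c c≢x (w ∷ ws) =
  ≡.trans (List.filter-reject (matches (x ∷ u)) {c ∷ w} {map (c ∷_) ws} (c≢x ∘ List.∷-injectiveˡ))
          (filter-prefix-mismatch c c≢x ws)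

filter-prefix-match : ∀ {x u} c → ∣ c ∣ ≡ x → (ws : List (List ℤ)) →
  filter (matches (x ∷ u)) (map (c ∷_) ws) ≡ map (c ∷_) (filter (matches u) ws)
filter-prefix-match c c≡x [] = refl
filter-prefix-match {x} {u} c c≡x (w ∷ ws) = byCases (matches u w)
  where
  rest = filter-prefix-match c c≡x ws
  byCases : Dec (map ∣_∣ w ≡ u) →
    filter (matches (x ∷ u)) (map (c ∷_) (w ∷ ws)) ≡ map (c ∷_) (filter (matches u) (w ∷ ws))
  byCases (yes p) =
    ≡.trans (List.filter-accept (matches (x ∷ u)) {c ∷ w} {map (c ∷_) ws} (cong₂ _∷_ c≡x p))
            (≡.trans (cong ((c ∷ w) ∷_) rest) (cong (map (c ∷_)) (≡.sym (List.filter-accept (matches u) {w} {ws} p))))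
  byCases (no ¬p) =
    ≡.trans (List.filter-reject (matches (x ∷ u)) {c ∷ w} {map (c ∷_) ws} (¬p ∘ List.∷-injectiveʳ))
            (≡.trans rest (cong (map (c ∷_)) (≡.sym (List.filter-reject (matches u) {w} {ws} ¬p))))

B'-signings : ∀ {n} v → All (_< n) v →
  filter (matches (map suc v)) (words (signedAlphabet n) (length v)) ≡ signings v
B'-signings []      []               = refl
B'-signings {n} (k ∷ v) (k<n ∷ bounds) = begin
  filter (matches u) (concatMap prefixWith (signedAlphabet n))
    ≡⟨ filter-concatMap (matches u) prefixWith (signedAlphabet n) ⟩
  concatMap (filter (matches u) ∘ prefixWith) (signedAlphabet n)
    ≡⟨ concatMap-signedAlphabet _ n k<n (λ c c≢ → filter-prefix-mismatch c c≢ ws) ⟩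
  filter (matches u) (prefixWith -[1+ k ]) ++ filter (matches u) (prefixWith (+ suc k))
    ≡⟨ cong₂ _++_ (filter-prefix-match _ refl ws) (filter-prefix-match _ refl ws) ⟩
  map (-[1+ k ] ∷_) (filter (matches (map suc v)) ws) ++ map (+ suc k ∷_) (filter (matches (map suc v)) ws)
    ≡⟨ cong (λ s → map (-[1+ k ] ∷_) s ++ map (+ suc k ∷_) s) (B'-signings v bounds) ⟩
  signings (k ∷ v) ∎
  where
  open ≡.≡-Reasoning
  u = suc k ∷ map suc v
  ws = words (signedAlphabet n) (length v)
  prefixWith : ℤ → List (List ℤ)
  prefixWith c = map (c ∷_) ws

shiftedLetters : ∀ {n} u → (∀ {x} → x ∈ u → x ∈ oneTo n) → Σ (List ℕ) λ v → u ≡ map suc v × All (_< n) v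
shiftedLetters []      _       = [] , refl , []
shiftedLetters (x ∷ u) inRange with ∈-map⁻ suc (inRange (here refl)) | shiftedLetters u (inRange ∘ there)
... | i , i∈ , refl | v , refl , bounds = i ∷ v , refl , ∈-upTo⁻ i∈ ∷ bounds

perm-shape : ∀ {n u} → IsPerm n u → Σ (List ℕ) λ v → u ≡ map suc v × All (_< n) v × length v ≡ n
perm-shape {n} {u} perm with shiftedLetters u (∈-resp-↭ perm)
... | v , refl , bounds = v , refl , bounds , lengthIsN
  where
  lengthIsN : length v ≡ n
  lengthIsN = ≡.trans (≡.sym (List.length-map suc v))
    (≡.trans (↭-length perm) (≡.trans (List.length-map suc (upTo n)) (List.length-upTo n)))

module Weights {a ℓ : Level} (R : CommutativeSemiring a ℓ) where
  open CommutativeSemiring R renaming (refl to ≈-refl)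
  open import Algebra.Definitions.RawSemiring rawSemiring using (_^_)
  open import Algebra.Properties.CommutativeSemiring.Exp R using (^-homo-*; ^-assocʳ; ^-congˡ; ^-distrib-*)
  open import Algebra.Properties.CommutativeSemigroup *-commutativeSemigroup using (interchange)
  open import Relation.Binary.Reasoning.Setoid setoid
  open import Algebra.Solver.Ring.NaturalCoefficients.Default R

  sumR-++ : ∀ xs ys → sumR R (xs ++ ys) ≈ sumR R xs + sumR R ys
  sumR-++ []       ys = sym (+-identityˡ _)
  sumR-++ (x ∷ xs) ys = trans (+-congˡ (sumR-++ xs ys)) (sym (+-assoc _ _ _))

  sumR-cong : ∀ {A : Set} {f g : A → Carrier} → (∀ x → f x ≈ g x) → ∀ xs → sumR R (map f xs) ≈ sumR R (map g xs)
  sumR-cong f≈g []       = ≈-refl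
  sumR-cong f≈g (x ∷ xs) = +-cong (f≈g x) (sumR-cong f≈g xs)

  sumR-*ˡ : ∀ {A : Set} c (f : A → Carrier) xs → sumR R (map (λ x → c * f x) xs) ≈ c * sumR R (map f xs)
  sumR-*ˡ c f []       = sym (zeroʳ c)
  sumR-*ˡ c f (x ∷ xs) = trans (+-congˡ (sumR-*ˡ c f xs)) (sym (distribˡ c _ _))

  sum-signings : ∀ (f : List ℤ → Carrier) k v →
    sumR R (map f (signings (k ∷ v)))
      ≈ sumR R (map (λ w → f (-[1+ k ] ∷ w)) (signings v)) + sumR R (map (λ w → f (+ suc k ∷ w)) (signings v))
  sum-signings f k v = begin
    sumR R (map f (map (-[1+ k ] ∷_) S ++ map (+ suc k ∷_) S))
      ≡⟨ cong (sumR R) (List.map-++ f (map (-[1+ k ] ∷_) S) _) ⟩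
    sumR R (map f (map (-[1+ k ] ∷_) S) ++ map f (map (+ suc k ∷_) S))
      ≈⟨ sumR-++ (map f (map (-[1+ k ] ∷_) S)) _ ⟩
    sumR R (map f (map (-[1+ k ] ∷_) S)) + sumR R (map f (map (+ suc k ∷_) S))
      ≡⟨ cong₂ (λ xs ys → sumR R xs + sumR R ys) (≡.sym (List.map-∘ S)) (≡.sym (List.map-∘ S)) ⟩
    sumR R (map (λ w → f (-[1+ k ] ∷ w)) S) + sumR R (map (λ w → f (+ suc k ∷ w)) S) ∎
    where S = signings v

  when : Bool → Carrier → Carrier
  when d x = if d then x else 1#

  descentProduct : {A : Set} → (A → A → Bool) → (ℕ → Carrier) → ℕ → List A → Carrier
  descentProduct lt f m (x ∷ y ∷ w) = when (lt y x) (f m) * descentProduct lt f (suc m) (y ∷ w)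
  descentProduct lt f m _           = 1#

  descent-step : ∀ d x y m (D : List ℕ) → let D′ = (if d then m ∷ [] else []) ++ D in
    x ^ length D′ * y ^ sum D′ ≈ when d (x * y ^ m) * (x ^ length D * y ^ sum D)
  descent-step true  x y m D = begin
    (x * x ^ length D) * y ^ (m ℕ.+ sum D)      ≈⟨ *-congˡ (^-homo-* y m (sum D)) ⟩
    (x * x ^ length D) * (y ^ m * y ^ sum D)    ≈⟨ interchange x _ _ _ ⟩
    (x * y ^ m) * (x ^ length D * y ^ sum D)    ∎
  descent-step false x y m D = sym (*-identityˡ _)

  descent-weight : ∀ {A : Set} (lt : A → A → Bool) x y m w →
    x ^ length (desPos lt w m) * y ^ sum (desPos lt w m) ≈ descentProduct lt (λ i → x * y ^ i) m w
  descent-weight lt x y m []          = *-identityˡ 1#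
  descent-weight lt x y m (_ ∷ [])    = *-identityˡ 1#
  descent-weight lt x y m (z ∷ z′ ∷ w) =
    trans (descent-step (lt z′ z) x y m (desPos lt (z′ ∷ w) (suc m)))
          (*-congˡ (descent-weight lt x y (suc m) (z′ ∷ w)))

  prodRange : (ℕ → Carrier) → ℕ → ℕ → Carrier
  prodRange h m zero    = 1#
  prodRange h m (suc k) = h m * prodRange h (suc m) k

  prodR-progression : ∀ (h : ℕ → Carrier) f m k → (∀ i → f i ≡ m ℕ.+ i) →
    prodR R (map h (applyUpTo f k)) ≡ prodRange h m k
  prodR-progression h f m zero    f≗ = refl
  prodR-progression h f m (suc k) f≗ = cong₂ _*_
    (cong h (≡.trans (f≗ 0) (ℕ.+-identityʳ m)))
    (prodR-progression h (f ∘ suc) (suc m) k (λ i → ≡.trans (f≗ (suc i)) (ℕ.+-suc m i)))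

  module _ (t q : Carrier) where

    x : ℕ → Carrier
    x i = t * q ^ i

    -- Weight of a signed descent at position i (fdes and fmaj count descents twice).
    signedDescent : ℕ → Carrier
    signedDescent i = (t * t) * (q * q) ^ i

    signedDescent-square : ∀ d m → when d (signedDescent m) ≈ when d (x m) * when d (x m)
    signedDescent-square true  m = trans (*-congˡ (^-distrib-* q q m)) (interchange t t (q ^ m) (q ^ m))
    signedDescent-square false m = sym (*-identityˡ 1#)

    pow-double : ∀ y L → y ^ (2 ℕ.* L) ≈ (y * y) ^ L
    pow-double y L = trans (sym (^-assocʳ y 2 L)) (^-congˡ L (*-congˡ (*-identityʳ y)))

    weight-split : ∀ b L S ν → t ^ (2 ℕ.* L ℕ.+ b) * q ^ (2 ℕ.* S ℕ.+ (b ℕ.+ ν))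
                               ≈ (t ^ b * q ^ b) * (((t * t) ^ L * (q * q) ^ S) * q ^ ν)
    weight-split b L S ν = begin
      t ^ (2 ℕ.* L ℕ.+ b) * q ^ (2 ℕ.* S ℕ.+ (b ℕ.+ ν))
        ≈⟨ *-cong (^-homo-* t (2 ℕ.* L) b) (trans (^-homo-* q (2 ℕ.* S) _) (*-congˡ (^-homo-* q b ν))) ⟩
      (t ^ (2 ℕ.* L) * t ^ b) * (q ^ (2 ℕ.* S) * (q ^ b * q ^ ν))
        ≈⟨ *-cong (*-congʳ (pow-double t L)) (*-congʳ (pow-double q S)) ⟩
      ((t * t) ^ L * t ^ b) * ((q * q) ^ S * (q ^ b * q ^ ν))
        ≈⟨ solve 5 (λ T Q tb qb qν → (T :* tb) :* (Q :* (qb :* qν)) := (tb :* qb) :* ((T :* Q) :* qν))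
                 ≈-refl ((t * t) ^ L) ((q * q) ^ S) (t ^ b) (q ^ b) (q ^ ν) ⟩
      (t ^ b * q ^ b) * (((t * t) ^ L * (q * q) ^ S) * q ^ ν) ∎

    tailWeight : ℕ → ℤ → List ℤ → Carrier
    tailWeight m p w = descentProduct ltB signedDescent m (p ∷ w) * q ^ neg w

    weight-neg : ∀ k w → t ^ fdes (-[1+ k ] ∷ w) * q ^ fmaj (-[1+ k ] ∷ w) ≈ x 1 * tailWeight 1 -[1+ k ] w
    weight-neg k w = trans (weight-split 1 (des ltB (-[1+ k ] ∷ w)) (maj ltB (-[1+ k ] ∷ w)) (neg w))
      (*-cong (*-congʳ (*-identityʳ t)) (*-congʳ (descent-weight ltB (t * t) (q * q) 1 (-[1+ k ] ∷ w))))

    weight-pos : ∀ k w → t ^ fdes (+ k ∷ w) * q ^ fmaj (+ k ∷ w) ≈ tailWeight 1 (+ k) w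
    weight-pos k w = trans (weight-split 0 (des ltB (+ k ∷ w)) (maj ltB (+ k ∷ w)) (neg w))
      (trans (trans (*-congʳ (*-identityˡ 1#)) (*-identityˡ _))
             (*-congʳ (descent-weight ltB (t * t) (q * q) 1 (+ k ∷ w))))

    signedTail : ℕ → ℤ → List ℕ → Carrier
    signedTail m p v = sumR R (map (tailWeight m p) (signings v))

    signedTail-cons : ∀ m p k v → let c₋ = when (ltB -[1+ k ] p) (x m); c₊ = when (ltB (+ suc k) p) (x m) in
      signedTail m p (k ∷ v) ≈ ((c₋ * c₋) * q) * signedTail (suc m) -[1+ k ] v + (c₊ * c₊) * signedTail (suc m) (+ suc k) v
    signedTail-cons m p k v = trans (sum-signings (tailWeight m p) k v) (+-cong
      (trans (sumR-cong negative (signings v)) (sumR-*ˡ _ (tailWeight (suc m) -[1+ k ]) (signings v)))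
      (trans (sumR-cong positive (signings v)) (sumR-*ˡ _ (tailWeight (suc m) (+ suc k)) (signings v))))
      where
      c₋ = when (ltB -[1+ k ] p) (x m)
      c₊ = when (ltB (+ suc k) p) (x m)
      negative : ∀ w → tailWeight m p (-[1+ k ] ∷ w) ≈ ((c₋ * c₋) * q) * tailWeight (suc m) -[1+ k ] w
      negative w = trans (interchange _ _ q _) (*-congʳ (*-congʳ (signedDescent-square (ltB -[1+ k ] p) m)))
      positive : ∀ w → tailWeight m p (+ suc k ∷ w) ≈ (c₊ * c₊) * tailWeight (suc m) (+ suc k) w
      positive w = trans (*-assoc _ _ _) (*-congʳ (signedDescent-square (ltB (+ suc k) p) m))

    -- The polynomial identity behind one step of the transfer recursion; X = t q^m,
    -- c = X or 1 according as position m is a descent of the unsigned word.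
    transfer-step : ∀ d X y P N → let c = when d X in
      (((X * X) * y) * N + (c * c) * P) + X * (((c * c) * y) * N + (1# * 1#) * P)
        ≈ (c * (1# + X)) * (P + (X * y) * N)
    transfer-step true  X y P N = solve 4 (λ X y P N →
      (((X :* X) :* y) :* N :+ (X :* X) :* P) :+ X :* (((X :* X) :* y) :* N :+ (con 1 :* con 1) :* P)
        := (X :* (con 1 :+ X)) :* (P :+ (X :* y) :* N)) ≈-refl X y P N
    transfer-step false X y P N = solve 4 (λ X y P N →
      (((X :* X) :* y) :* N :+ (con 1 :* con 1) :* P) :+ X :* (((con 1 :* con 1) :* y) :* N :+ (con 1 :* con 1) :* P)
        := (con 1 :* (con 1 :+ X)) :* (P :+ (X :* y) :* N)) ≈-refl X y P N

    g : ℕ → Carrier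
    g i = 1# + t * q ^ i

    transfer : ∀ k v m → signedTail m (+ suc k) v + x m * signedTail m -[1+ k ] v
                         ≈ descentProduct ltℕ x m (suc k ∷ map suc v) * prodRange g m (suc (length v))
    transfer k []      m = solve 1 (λ X → ((con 1 :* con 1) :+ con 0) :+ X :* ((con 1 :* con 1) :+ con 0)
                                       := con 1 :* ((con 1 :+ X) :* con 1)) ≈-refl (x m)
    transfer k (l ∷ v) m = begin
      signedTail m (+ suc k) (l ∷ v) + x m * signedTail m -[1+ k ] (l ∷ v)
        ≈⟨ +-cong (signedTail-cons m (+ suc k) l v) (*-congˡ (signedTail-cons m -[1+ k ] l v)) ⟩
      (((x m * x m) * q) * N + (e * e) * P) + x m * (((e * e) * q) * N + (1# * 1#) * P)
        ≈⟨ transfer-step (l <ᵇ k) (x m) q P N ⟩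
      (e * g m) * (P + (x m * q) * N)
        ≈⟨ *-congˡ (trans (+-congˡ (*-congʳ shift)) (transfer l v (suc m))) ⟩
      (e * g m) * (descentProduct ltℕ x (suc m) (suc l ∷ map suc v) * prodRange g (suc m) (suc (length v)))
        ≈⟨ interchange e (g m) _ _ ⟩
      descentProduct ltℕ x m (suc k ∷ suc l ∷ map suc v) * prodRange g m (suc (length (l ∷ v))) ∎
      where
      e = when (l <ᵇ k) (x m)
      P = signedTail (suc m) (+ suc l) v
      N = signedTail (suc m) -[1+ l ] v
      shift : x m * q ≈ x (suc m)
      shift = trans (*-assoc t (q ^ m) q) (*-congˡ (*-comm (q ^ m) q))

    identity-shifted : ∀ k v → All (_< suc (length v)) (k ∷ v) →
      lhs7 R (suc (length v)) (suc k ∷ map suc v) t q ≈ rhs7 R (suc (length v)) (suc k ∷ map suc v) t q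
    identity-shifted k v bounds = begin
      lhs7 R n u t q
        ≈⟨ *-cong (descent-weight ltℕ t q 1 u) (reflexive product) ⟩
      descentProduct ltℕ x 1 u * prodRange g 1 n
        ≈⟨ sym (transfer k v 1) ⟩
      signedTail 1 (+ suc k) v + x 1 * signedTail 1 -[1+ k ] v
        ≈⟨ +-comm _ _ ⟩
      x 1 * signedTail 1 -[1+ k ] v + signedTail 1 (+ suc k) v
        ≈⟨ sym (+-cong (trans (sumR-cong (weight-neg k) (signings v)) (sumR-*ˡ (x 1) (tailWeight 1 -[1+ k ]) (signings v)))
                       (sumR-cong (weight-pos (suc k)) (signings v))) ⟩
      sumR R (map (λ w → W (-[1+ k ] ∷ w)) (signings v)) + sumR R (map (λ w → W (+ suc k ∷ w)) (signings v))
        ≈⟨ sym (sum-signings W k v) ⟩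
      sumR R (map W (signings (k ∷ v)))
        ≡⟨ cong (λ ws → sumR R (map W ws)) (≡.sym (B'-signings (k ∷ v) bounds)) ⟩
      rhs7 R n u t q ∎
      where
      n = suc (length v)
      u = suc k ∷ map suc v
      W : List ℤ → Carrier
      W w = t ^ fdes w * q ^ fmaj w
      product : prodR R (map g (oneTo n)) ≡ prodRange g 1 n
      product = ≡.trans (cong (prodR R ∘ map g) (List.map-upTo suc n)) (prodR-progression g suc 1 n (λ _ → refl))

theorem7 : {c ℓ : Level} (R : CommutativeSemiring c ℓ) (n : ℕ) → 1 ≤ n → (u : List ℕ) →
    IsPerm n u → (t q : CommutativeSemiring.Carrier R) →
    CommutativeSemiring._≈_ R (lhs7 R n u t q) (rhs7 R n u t q)
theorem7 R n 1≤n u perm t q with perm-shape perm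
theorem7 R _ () _ _ t q | [] , refl , [] , refl
theorem7 R _ _  _ _ t q | k ∷ v , refl , bounds , refl = Weights.identity-shifted R t q k v bounds
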